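{- Let $n\ge 3$ and let $(p_1,\ldots,p_{n-1})$ be an admissible $(n-1)$-tuple. If $p_2$ is even, then $\mathcal{P}(p_1,\ldots,p_{n-1})$ has the flat amalgamation property with respect to its $2$-faces; that is, adding the relations $x_i=1$ for all $i\ge 2$ to the presentation of $\Gamma(p_1,\ldots,p_{n-1})$ yields a presentation of the subgroup $\langle x_0,x_1\rangle$ (i.e. the natural quotient map restricted to $\langle x_0,x_1\rangle$ is an isomorphism onto the resulting quotient). If $p_{n-2}$ is even, then $\mathcal{P}(p_1,\ldots,p_{n-1})$ has the flat amalgamation property with respect to its co-$(n-3)$-faces; that is, adding the relations $x_i=1$ for all $i\le n-3$ yields a presentation of the subgroup $\langle x_{n-2},x_{n-1}\rangle$.
   Context: An $(n-1)$-tuple $(p_1,\ldots,p_{n-1})$ of integers $\ge 2$ is admissible if whenever $p_i$ is odd, each of $p_{i-1}$ and $p_{i+1}$ (when its index lies in $\{1,\ldots,n-1\}$) is an even divisor of $2p_i$. For such a tuple, $\Gamma(p_1,\ldots,p_{n-1})$ is the group generated by $x_0,\ldots,x_{n-1}$ subject to $x_j^2=1$, $(x_{j-1}x_j)^{p_j}=1$ ($1\le j\le n-1$), $(x_jx_k)^2=1$ for $|j-k|\ge 2$, and $r_j=1$ for $1\le j\le n-2$, where $r_j=(x_{j-1}x_jx_{j+1}x_j)^2$ if $p_j,p_{j+1}$ are both even, $r_j=(x_{j-1}x_jx_{j+1}x_jx_{j+1})^2$ if $p_j$ is odd and $p_{j+1}$ even, and $r_j=(x_{j+1}x_jx_{j-1}x_jx_{j-1})^2$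 if $p_j$ is even and $p_{j+1}$ odd. $\mathcal{P}(p_1,\ldots,p_{n-1})$ is the poset built from $\Gamma=\Gamma(p_1,\ldots,p_{n-1})$ as follows: for $0\le i\le n-1$ its $i$-faces are the right cosets $\Gamma_i\varphi$ of $\Gamma_i=\langle x_j : j\ne i\rangle$, with $\Gamma_i\varphi\le\Gamma_j\psi$ iff $i\le j$ and $\Gamma_i\varphi\cap\Gamma_j\psi\neq\emptyset$, together with a least face of rank $-1$ and a greatest face of rank $n$. In general, $\mathcal{P}$ (with generators $x_0,\ldots,x_{n-1}$) has the flat amalgamation property with respect to its $k$-faces if adding the relations $x_i=1$ for $i\ge k$ to the presentation of $\Gamma$ yields a presentation for $\langle x_0,\ldots,x_{k-1}\rangle$, and with respect to its co-$k$-faces if adding $x_i=1$ for $i\le k$ yields a presentation for $\langle x_{k+1},\ldots,x_{n-1}\rangle$. -}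

module Defs where

open import Data.Nat using (ℕ; zero; suc; _+_; _*_; _∸_; _≤_; _<_)
open import Data.Nat.Divisibility using (_∣_)
open import Data.Fin using (Fin; toℕ; fromℕ<)
open import Data.Bool using (Bool; true; false; not)
open import Data.List using (List; []; _∷_; _++_; replicate; concat)
open import Data.List.Relation.Unary.All using (All)
open import Data.Product using (_×_; _,_; Σ; proj₁; ∃)
open import Data.Sum using (_⊎_)
open import Data.Vec using (Vec; []; _∷_)
open import Relation.Nullary using (¬_)
open import Relation.Binary.PropositionalEquality using (_≡_)
open import Relation.Binary.Construct.Closure.Equivalence using (EqClosure)

Even : ℕ → Set
Even k = 2 ∣ k

Odd : ℕ → Set
Odd k = ¬ Even k

-- Words in the free group on generators x_0 … x_{N-1}.
-- A letter (i , false) is x_i, a letter (i , true) is x_i⁻¹.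

Letter : ℕ → Set
Letter N = Fin N × Bool

Word : ℕ → Set
Word N = List (Letter N)

invL : ∀ {N} → Letter N → Letter N
invL (i , b) = (i , not b)

pow : ∀ {N} → Word N → ℕ → Word N
pow w k = concat (replicate k w)

-- Two words represent the same element iff
-- they are related by the equivalence closure of: free cancellation
-- of a x_i^{±1} x_i^{∓1} pair, and deletion of a relator occurrence.

data Step {N : ℕ} (R : Word N → Set) : Word N → Word N → Set where
  cancel : (u v : Word N) (a : Letter N) →
           Step R (u ++ (a ∷ invL a ∷ v)) (u ++ v)
  delete : (u v r : Word N) → R r → Step R (u ++ (r ++ v)) (u ++ v)

EqIn : ∀ {N} → (Word N → Set) → Word N → Word N → Set
EqIn R = EqClosure (Step R)

-- The tuple (p_1,…,p_m), m = n-1, as a vector; pAt p j = p_j (1-indexed),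
-- with junk value 0 outside 1 ≤ j ≤ m (never used there).

pAt : ∀ {m} → Vec ℕ m → ℕ → ℕ
pAt []          _             = 0
pAt (a ∷ v)     zero          = 0
pAt (a ∷ v)     (suc zero)    = a
pAt (a ∷ v)     (suc (suc k)) = pAt v (suc k)

Admissible : ∀ {m} → Vec ℕ m → Set
Admissible {m} p =
  (∀ i → 1 ≤ i → i ≤ m → 2 ≤ pAt p i) ×
  (∀ i → 1 ≤ i → i ≤ m → Odd (pAt p i) →
     (2 ≤ i → Even (pAt p (i ∸ 1)) × (pAt p (i ∸ 1) ∣ 2 * pAt p i)) ×
     (i + 1 ≤ m → Even (pAt p (i + 1)) × (pAt p (i + 1) ∣ 2 * pAt p i)))

-- Relators of Γ(p_1,…,p_m), generators x_0,…,x_m (n = m+1 generators).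

x : ∀ {N} (i : ℕ) → i < N → Word N
x i i<N = (fromℕ< i<N , false) ∷ []

data RelΓ (m : ℕ) (p : Vec ℕ m) : Word (suc m) → Set where
  inv  : (j : ℕ) (h : j < suc m) → RelΓ m p (pow (x j h) 2)
  brd  : (j : ℕ) (h₀ : j ∸ 1 < suc m) (h₁ : j < suc m) → 1 ≤ j →
         RelΓ m p (pow (x (j ∸ 1) h₀ ++ x j h₁) (pAt p j))
  com  : (j k : ℕ) (hj : j < suc m) (hk : k < suc m) →
         (j + 2 ≤ k ⊎ k + 2 ≤ j) →
         RelΓ m p (pow (x j hj ++ x k hk) 2)
  rEE  : (j : ℕ) (h₀ : j ∸ 1 < suc m) (h₁ : j < suc m) (h₂ : j + 1 < suc m) →
         1 ≤ j → Even (pAt p j) → Even (pAt p (j + 1)) →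
         RelΓ m p (pow (x (j ∸ 1) h₀ ++ x j h₁ ++ x (j + 1) h₂ ++ x j h₁) 2)
  rOE  : (j : ℕ) (h₀ : j ∸ 1 < suc m) (h₁ : j < suc m) (h₂ : j + 1 < suc m) →
         1 ≤ j → Odd (pAt p j) → Even (pAt p (j + 1)) →
         RelΓ m p (pow (x (j ∸ 1) h₀ ++ x j h₁ ++ x (j + 1) h₂ ++ x j h₁
                        ++ x (j + 1) h₂) 2)
  rEO  : (j : ℕ) (h₀ : j ∸ 1 < suc m) (h₁ : j < suc m) (h₂ : j + 1 < suc m) →
         1 ≤ j → Even (pAt p j) → Odd (pAt p (j + 1)) →
         RelΓ m p (pow (x (j + 1) h₂ ++ x j h₁ ++ x (j ∸ 1) h₀ ++ x j h₁
                        ++ x (j ∸ 1) h₀) 2)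

AddKill : ∀ {N} → (Word N → Set) → (Fin N → Set) → Word N → Set
AddKill R Kill r = R r ⊎ (Σ _ λ i → Kill i × r ≡ (i , false) ∷ [])

-- Adding x_i = 1 for i ∈ Kill to ⟨Fin N ∣ R⟩ yields a presentation of the
-- subgroup generated by the remaining generators (Keep = ¬ Kill):
-- the natural map from ⟨x_i : Keep i⟩ ≤ ⟨Fin N ∣ R⟩ to the quotient
-- ⟨Fin N ∣ R, x_i (Kill i)⟩ is injective and surjective.  Elements of the
-- subgroup are exactly those represented by words in the kept letters.
YieldsPresentation : ∀ {N} → (Word N → Set) → (Fin N → Set) → Set
YieldsPresentation {N} R Kill =
  (∀ (u v : Word N) →
     All (λ a → ¬ Kill (proj₁ a)) u → All (λ a → ¬ Kill (proj₁ a)) v →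
     EqIn (AddKill R Kill) u v → EqIn R u v) ×
  (∀ (w : Word N) → ∃ λ (u : Word N) →
     All (λ a → ¬ Kill (proj₁ a)) u × EqIn (AddKill R Kill) w u)

FlatAmalgFaces : (m : ℕ) → Vec ℕ m → ℕ → Set
FlatAmalgFaces m p k = YieldsPresentation (RelΓ m p) (λ i → k ≤ toℕ i)

FlatAmalgCoFaces : (m : ℕ) → Vec ℕ m → ℕ → Set
FlatAmalgCoFaces m p k = YieldsPresentation (RelΓ m p) (λ i → toℕ i ≤ k)

-- Deleting the letters x_i with i in the killed set K is an endomorphism of the
-- free monoid that fixes the words in the kept generators and sends the added
-- relators x_i to the empty word.  It therefore descends to a retraction of
-- ⟨ Γ ∣ x_i = 1 (i ∈ K) ⟩ onto ⟨ x_i : i ∉ K ⟩ ≤ Γ, which is the flat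
-- amalgamation property, as soon as it sends every relator of Γ to 1 in Γ.  A
-- relator in kept letters only is sent to itself; one meeting K is sent to a
-- word that collapses using x_i² = 1 (or to a commutation relator), unless it
-- involves x_{i-1} and x_i on different sides of K with p_i odd.  So it suffices
-- that the labels p_i across K are even; for the 2-faces the only one is p_2, for
-- the co-(n-3)-faces it is p_{n-2}.
module Submission where

open import Defs
open import Data.Nat using (ℕ; zero; suc; _+_; _*_; _∸_; _≤_; _<_; z≤n; s≤s; s≤s⁻¹; _≤?_)
open import Data.Nat.Properties using (+-suc; +-comm; ≤-reflexive; ≤-antisym; m≤n⇒m≤1+n; <⇒≤; ≰⇒>)
open import Data.Nat.Divisibility using (divides)
open import Data.Fin using (Fin; toℕ; fromℕ<)
open import Data.Fin.Properties using (toℕ-fromℕ<)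
open import Data.Bool using (false; true)
open import Data.List using ([]; _∷_; _++_)
open import Data.List.Properties using (++-assoc; ++-identityʳ)
open import Data.List.Relation.Unary.All using (All; []; _∷_)
open import Data.Product using (_×_; _,_; proj₁)
import Data.Product as Product
open import Data.Sum using (_⊎_; inj₁; inj₂)
import Data.Sum as Sum
open import Data.Vec using (Vec)
open import Function using (_∘_)
open import Relation.Nullary using (¬_; Dec; yes; no; contradiction)
open import Relation.Unary using (Decidable)
open import Relation.Binary.PropositionalEquality using (_≡_; refl; sym; trans; cong; subst; subst₂)
import Relation.Binary.Construct.On as On
open import Relation.Binary.Construct.Closure.Equivalence using (gmap; fold; isEquivalence)
open import Relation.Binary.Construct.Closure.Symmetric using (fwd; bwd)
open import Relation.Binary.Construct.Closure.ReflexiveTransitive using (ε; _◅_; _◅◅_)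

pow-[] : ∀ {N} k → pow {N} [] k ≡ []
pow-[] zero    = refl
pow-[] (suc k) = pow-[] k

module Presentation {N : ℕ} (R : Word N → Set) where

  infix 4 _≈_
  _≈_ : Word N → Word N → Set
  _≈_ = EqIn R

  step : ∀ {u v} → Step R u v → u ≈ v
  step s = fwd s ◅ ε

  relator≈[] : ∀ {r} → R r → r ≈ []
  relator≈[] {r} r∈R = subst (_≈ []) (++-identityʳ r) (step (delete [] [] r r∈R))

  Step-++ˡ : ∀ w {u v} → Step R u v → Step R (w ++ u) (w ++ v)
  Step-++ˡ w (cancel u v a) =
    subst₂ (Step R) (++-assoc w u _) (++-assoc w u v) (cancel (w ++ u) v a)
  Step-++ˡ w (delete u v r r∈R) =
    subst₂ (Step R) (++-assoc w u _) (++-assoc w u v) (delete (w ++ u) v r r∈R)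

  Step-++ʳ : ∀ w {u v} → Step R u v → Step R (u ++ w) (v ++ w)
  Step-++ʳ w (cancel u v a) =
    subst₂ (Step R) (sym (++-assoc u (a ∷ invL a ∷ v) w)) (sym (++-assoc u v w))
      (cancel u (v ++ w) a)
  Step-++ʳ w (delete u v r r∈R) =
    subst₂ (Step R) (trans (cong (u ++_) (sym (++-assoc r v w))) (sym (++-assoc u (r ++ v) w)))
      (sym (++-assoc u v w)) (delete u (v ++ w) r r∈R)

  ≈-++ˡ : ∀ w {u v} → u ≈ v → w ++ u ≈ w ++ v
  ≈-++ˡ w = gmap (w ++_) (Step-++ˡ w)

  ≈-++ʳ : ∀ w {u v} → u ≈ v → u ++ w ≈ v ++ w
  ≈-++ʳ w = gmap (_++ w) (Step-++ʳ w)

  Involutive : Letter N → Set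
  Involutive a = ∀ v → a ∷ a ∷ v ≈ v

  module _ {a : Letter N} (a² : Involutive a) where

    even-power≈[] : ∀ {k} → Even k → pow (a ∷ []) k ≈ []
    even-power≈[] (divides q refl) = go q
      where
      go : ∀ q → pow (a ∷ []) (q * 2) ≈ []
      go zero    = ε
      go (suc q) = a² _ ◅◅ go q

    module _ {b : Letter N} (b² : Involutive b) where

      [ab²]²≈[] : a ∷ b ∷ b ∷ a ∷ b ∷ b ∷ [] ≈ []
      [ab²]²≈[] = ≈-++ˡ (a ∷ []) (b² _) ◅◅ a² _ ◅◅ b² []

      [aba]²≈[] : a ∷ b ∷ a ∷ a ∷ b ∷ a ∷ [] ≈ []
      [aba]²≈[] = ≈-++ˡ (a ∷ b ∷ []) (a² _) ◅◅ ≈-++ˡ (a ∷ []) (b² _) ◅◅ a² []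

module Erasure {N : ℕ} (R : Word N → Set) {K : Fin N → Set} (K? : Decidable K) where

  open Presentation R

  Kept : Letter N → Set
  Kept a = ¬ K (proj₁ a)

  prependIfKept : (a : Letter N) → Dec (K (proj₁ a)) → Word N → Word N
  prependIfKept a (yes _) w = w
  prependIfKept a (no _)  w = a ∷ w

  erase : Word N → Word N
  erase []      = []
  erase (a ∷ w) = prependIfKept a (K? (proj₁ a)) (erase w)

  erase-++ : ∀ u v → erase (u ++ v) ≡ erase u ++ erase v
  erase-++ []      v = refl
  erase-++ (a ∷ u) v rewrite erase-++ u v with K? (proj₁ a)
  ... | yes _ = refl
  ... | no  _ = refl

  erase-pow : ∀ w k → erase (pow w k) ≡ pow (erase w) k
  erase-pow w zero    = refl
  erase-pow w (suc k) = trans (erase-++ w (pow w k)) (cong (erase w ++_) (erase-pow w k))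

  erase-fixes-kept : ∀ {w} → All Kept w → erase w ≡ w
  erase-fixes-kept {[]}    []                   = refl
  erase-fixes-kept {a ∷ w} (a-kept ∷ w-kept) with K? (proj₁ a)
  ... | yes a-killed = contradiction a-killed a-kept
  ... | no  _        = cong (a ∷_) (erase-fixes-kept w-kept)

  all-kept-erase : ∀ w → All Kept (erase w)
  all-kept-erase []      = []
  all-kept-erase (a ∷ w) with K? (proj₁ a)
  ... | yes _     = all-kept-erase w
  ... | no a-kept = a-kept ∷ all-kept-erase w

  module Killing = Presentation (AddKill R K)

  word≈erase : ∀ w → Killing._≈_ w (erase w)
  word≈erase []            = ε
  word≈erase ((i , b) ∷ w) with K? i
  ... | yes i∈K = drop b ◅◅ word≈erase w
    where
    kill : Step (AddKill R K) ((i , false) ∷ w) w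
    kill = delete [] w ((i , false) ∷ []) (inj₂ (i , i∈K , refl))
    drop : ∀ b → Killing._≈_ ((i , b) ∷ w) w
    drop false = fwd kill ◅ ε
    drop true  = bwd (Killing.Step-++ˡ ((i , true) ∷ []) kill) ◅ fwd (cancel [] w (i , true)) ◅ ε
  ... | no _ = Killing.≈-++ˡ ((i , b) ∷ []) (word≈erase w)

  module _ (erase-relator : ∀ {r} → R r → erase r ≈ []) where

    erase-Step : ∀ {u v} → Step (AddKill R K) u v → erase u ≈ erase v
    erase-Step (cancel u v (i , b)) rewrite erase-++ u ((i , b) ∷ invL (i , b) ∷ v) | erase-++ u v
      with K? i
    ... | yes _ = ε
    ... | no  _ = step (cancel (erase u) (erase v) (i , b))
    erase-Step (delete u v r (inj₁ r∈R)) rewrite erase-++ u (r ++ v) | erase-++ r v | erase-++ u v =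
      ≈-++ˡ (erase u) (≈-++ʳ (erase v) (erase-relator r∈R))
    erase-Step (delete u v _ (inj₂ (i , i∈K , refl))) rewrite erase-++ u ((i , false) ∷ v) | erase-++ u v
      with K? i
    ... | yes _    = ε
    ... | no  i∉K  = contradiction i∈K i∉K

    erase-respects-≈ : ∀ {u v} → Killing._≈_ u v → erase u ≈ erase v
    erase-respects-≈ = fold (On.isEquivalence erase (isEquivalence (Step R))) erase-Step

    erasure-yieldsPresentation : YieldsPresentation R K
    erasure-yieldsPresentation =
      (λ u v u-kept v-kept u≈v →
         subst₂ _≈_ (erase-fixes-kept u-kept) (erase-fixes-kept v-kept) (erase-respects-≈ u≈v))
      , λ w → erase w , all-kept-erase w , word≈erase w

Separates : (ℕ → Set) → ℕ → Set
Separates K i = (K i × ¬ K (suc i)) ⊎ (¬ K i × K (suc i))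

EvenAcross : ∀ {m} → Vec ℕ m → (ℕ → Set) → Set
EvenAcross {m} p K = ∀ {i} → i < m → Separates K i → Even (pAt p (suc i))

module ErasureΓ {m : ℕ} (p : Vec ℕ m) {K : ℕ → Set} (K? : Decidable K)
                (even-across : EvenAcross p K) where

  open Presentation (RelΓ m p)
  open Erasure (RelΓ m p) (K? ∘ toℕ)

  -- Relator letters are fromℕ< h, whose index is j only up to toℕ-fromℕ< h.
  Killed : ∀ {j} → j < suc m → Set
  Killed h = K (toℕ (fromℕ< h))

  killed? : ∀ {j} (h : j < suc m) → Dec (Killed h)
  killed? h = K? (toℕ (fromℕ< h))

  Killed⇒K : ∀ {j} (h : j < suc m) → Killed h → K j
  Killed⇒K h = subst K (toℕ-fromℕ< h)

  ¬Killed⇒¬K : ∀ {j} (h : j < suc m) → ¬ Killed h → ¬ K j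
  ¬Killed⇒¬K h ¬killed = ¬killed ∘ subst K (sym (toℕ-fromℕ< h))

  even-bond : ∀ {i j} (hi : i < suc m) (hj : j < suc m) → j ≡ suc i →
              (Killed hi × ¬ Killed hj) ⊎ (¬ Killed hi × Killed hj) → Even (pAt p j)
  even-bond hi hj refl =
    even-across (s≤s⁻¹ hj) ∘
      Sum.map (Product.map (Killed⇒K hi) (¬Killed⇒¬K hj)) (Product.map (¬Killed⇒¬K hi) (Killed⇒K hj))

  x²≈[] : ∀ {j} (h : j < suc m) → Involutive (fromℕ< h , false)
  x²≈[] {j} h v = step (delete [] v (pow (x j h) 2) (inv j h))

  x⁴≈[] : ∀ {j} (h : j < suc m) → pow (x j h) 4 ≈ []
  x⁴≈[] h = even-power≈[] (x²≈[] h) (divides 2 refl)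

  erase-inv : ∀ j (h : j < suc m) → erase (pow (x j h) 2) ≈ []
  erase-inv j h with killed? h
  ... | yes _ = ε
  ... | no  _ = x²≈[] h []

  erase-brd : ∀ i (h₀ : i < suc m) (h₁ : suc i < suc m) →
              erase (pow (x i h₀ ++ x (suc i) h₁) (pAt p (suc i))) ≈ []
  erase-brd i h₀ h₁ rewrite erase-pow (x i h₀ ++ x (suc i) h₁) (pAt p (suc i))
    with killed? h₀ | killed? h₁
  ... | yes _  | yes _  = subst (_≈ []) (sym (pow-[] (pAt p (suc i)))) ε
  ... | yes k₀ | no  n₁ = even-power≈[] (x²≈[] h₁) (even-bond h₀ h₁ refl (inj₁ (k₀ , n₁)))
  ... | no  n₀ | yes k₁ = even-power≈[] (x²≈[] h₀) (even-bond h₀ h₁ refl (inj₂ (n₀ , k₁)))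
  ... | no  _  | no  _  = relator≈[] (brd (suc i) h₀ h₁ (s≤s z≤n))

  erase-com : ∀ j k (hj : j < suc m) (hk : k < suc m) → (j + 2 ≤ k ⊎ k + 2 ≤ j) →
              erase (pow (x j hj ++ x k hk) 2) ≈ []
  erase-com j k hj hk apart with killed? hj | killed? hk
  ... | yes _ | yes _ = ε
  ... | yes _ | no  _ = x²≈[] hk []
  ... | no  _ | yes _ = x²≈[] hj []
  ... | no  _ | no  _ = relator≈[] (com j k hj hk apart)

  erase-rEE : ∀ i (h₀ : i < suc m) (h₁ : suc i < suc m) (h₂ : suc i + 1 < suc m) →
              Even (pAt p (suc i)) → Even (pAt p (suc i + 1)) →
              erase (pow (x i h₀ ++ x (suc i) h₁ ++ x (suc i + 1) h₂ ++ x (suc i) h₁) 2) ≈ []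
  erase-rEE i h₀ h₁ h₂ even₁ even₂ with killed? h₀ | killed? h₁ | killed? h₂
  ... | no  _ | no  _ | no  _ = relator≈[] (rEE (suc i) h₀ h₁ h₂ (s≤s z≤n) even₁ even₂)
  ... | no  _ | no  _ | yes _ = [ab²]²≈[] (x²≈[] h₀) (x²≈[] h₁)
  ... | no  _ | yes _ | no  _ = relator≈[] (com i (suc i + 1) h₀ h₂ (inj₁ (≤-reflexive (+-suc i 1))))
  ... | no  _ | yes _ | yes _ = x²≈[] h₀ []
  ... | yes _ | no  _ | no  _ = [aba]²≈[] (x²≈[] h₁) (x²≈[] h₂)
  ... | yes _ | no  _ | yes _ = x⁴≈[] h₁
  ... | yes _ | yes _ | no  _ = x²≈[] h₂ []
  ... | yes _ | yes _ | yes _ = ε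

  erase-rOE : ∀ i (h₀ : i < suc m) (h₁ : suc i < suc m) (h₂ : suc i + 1 < suc m) →
              Odd (pAt p (suc i)) → Even (pAt p (suc i + 1)) →
              erase (pow (x i h₀ ++ x (suc i) h₁ ++ x (suc i + 1) h₂ ++ x (suc i) h₁
                          ++ x (suc i + 1) h₂) 2) ≈ []
  erase-rOE i h₀ h₁ h₂ odd₁ even₂ with killed? h₀ | killed? h₁ | killed? h₂
  ... | no  _  | no  _  | no  _ = relator≈[] (rOE (suc i) h₀ h₁ h₂ (s≤s z≤n) odd₁ even₂)
  ... | no  _  | no  _  | yes _ = [ab²]²≈[] (x²≈[] h₀) (x²≈[] h₁)
  ... | no  _  | yes _  | no  _ = [ab²]²≈[] (x²≈[] h₀) (x²≈[] h₂)
  ... | no  _  | yes _  | yes _ = x²≈[] h₀ []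
  ... | yes k₀ | no  n₁ | no  _ = contradiction (even-bond h₀ h₁ refl (inj₁ (k₀ , n₁))) odd₁
  ... | yes _  | no  _  | yes _ = x⁴≈[] h₁
  ... | yes _  | yes _  | no  _ = x⁴≈[] h₂
  ... | yes _  | yes _  | yes _ = ε

  erase-rEO : ∀ j (h₀ : j ∸ 1 < suc m) (h₁ : j < suc m) (h₂ : j + 1 < suc m) → 1 ≤ j →
              Even (pAt p j) → Odd (pAt p (j + 1)) →
              erase (pow (x (j + 1) h₂ ++ x j h₁ ++ x (j ∸ 1) h₀ ++ x j h₁
                          ++ x (j ∸ 1) h₀) 2) ≈ []
  erase-rEO j h₀ h₁ h₂ 1≤j even₁ odd₂ with killed? h₀ | killed? h₁ | killed? h₂
  ... | no  _ | no  _  | no  _  = relator≈[] (rEO j h₀ h₁ h₂ 1≤j even₁ odd₂)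
  ... | no  _ | no  n₁ | yes k₂ = contradiction (even-bond h₁ h₂ (+-comm j 1) (inj₂ (n₁ , k₂))) odd₂
  ... | no  _ | yes _  | no  _  = [ab²]²≈[] (x²≈[] h₂) (x²≈[] h₀)
  ... | no  _ | yes _  | yes _  = x⁴≈[] h₀
  ... | yes _ | no  _  | no  _  = [ab²]²≈[] (x²≈[] h₂) (x²≈[] h₁)
  ... | yes _ | no  _  | yes _  = x⁴≈[] h₁
  ... | yes _ | yes _  | no  _  = x²≈[] h₂ []
  ... | yes _ | yes _  | yes _  = ε

  erase-relator : ∀ {r} → RelΓ m p r → erase r ≈ []
  erase-relator (inv j h)                               = erase-inv j h
  erase-relator (brd (suc i) h₀ h₁ (s≤s z≤n))           = erase-brd i h₀ h₁
  erase-relator (com j k hj hk apart)                   = erase-com j k hj hk apart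
  erase-relator (rEE (suc i) h₀ h₁ h₂ (s≤s z≤n) e₁ e₂) = erase-rEE i h₀ h₁ h₂ e₁ e₂
  erase-relator (rOE (suc i) h₀ h₁ h₂ (s≤s z≤n) o₁ e₂) = erase-rOE i h₀ h₁ h₂ o₁ e₂
  erase-relator (rEO j h₀ h₁ h₂ 1≤j e₁ o₂)             = erase-rEO j h₀ h₁ h₂ 1≤j e₁ o₂

  yieldsPresentation : YieldsPresentation (RelΓ m p) (K ∘ toℕ)
  yieldsPresentation = erasure-yieldsPresentation erase-relator

evenAcross-≥ : ∀ {m} (p : Vec ℕ m) k → Even (pAt p k) → EvenAcross p (k ≤_)
evenAcross-≥ p k even _ (inj₁ (k≤i , k≰1+i)) = contradiction (m≤n⇒m≤1+n k≤i) k≰1+i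
evenAcross-≥ p k even _ (inj₂ (k≰i , k≤1+i)) =
  subst (Even ∘ pAt p) (≤-antisym k≤1+i (≰⇒> k≰i)) even

evenAcross-≤ : ∀ {m} (p : Vec ℕ m) k → Even (pAt p (suc k)) → EvenAcross p (_≤ k)
evenAcross-≤ p k even _ (inj₁ (i≤k , 1+i≰k)) =
  subst (Even ∘ pAt p ∘ suc) (≤-antisym (s≤s⁻¹ (≰⇒> 1+i≰k)) i≤k) even
evenAcross-≤ p k even _ (inj₂ (i≰k , 1+i≤k)) = contradiction (<⇒≤ 1+i≤k) i≰k

flatAmalgFaces : ∀ {m} (p : Vec ℕ m) k → Even (pAt p k) → FlatAmalgFaces m p k
flatAmalgFaces p k even = ErasureΓ.yieldsPresentation p (k ≤?_) (evenAcross-≥ p k even)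

flatAmalgCoFaces : ∀ {m} (p : Vec ℕ m) k → Even (pAt p (suc k)) → FlatAmalgCoFaces m p k
flatAmalgCoFaces p k even = ErasureΓ.yieldsPresentation p (_≤? k) (evenAcross-≤ p k even)

proposition4p5 : (m : ℕ) → 2 ≤ m → (p : Vec ℕ m) → Admissible p →
    (Even (pAt p 2) → FlatAmalgFaces m p 2) ×
    (Even (pAt p (m ∸ 1)) → FlatAmalgCoFaces m p (m ∸ 2))
proposition4p5 (suc (suc n)) _ p _ = flatAmalgFaces p 2 , flatAmalgCoFaces p n
proposition4p5 (suc zero) (s≤s ()) _ _
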